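{- Let $G$ be a graph, let $L$ be a set of specified leaks on $V(G)$, and let $\ell=I(L)$. Then every specified $\ell$-leaky forcing set of $G$ is an $L$-leaky forcing set of $G$. That is, $\operatorname{Z}_{(L)}(G)\leq \operatorname{Z}^s_{(\ell)}(G)$.
   Context: All graphs are finite simple graphs. Given a graph $G$ and a set $B\subseteq V(G)$ of initially blue vertices (all other vertices white), the zero forcing color-change rule says: if a blue vertex $u$ has exactly one white neighbor $w$, then $u$ may force $w$ (written $u\rightarrow w$). A specified leak $v\rightarrow u$ (for adjacent $v,u$) prohibits the single force of $v$ forcing $u$; $v$ is its tail and $u$ its head. For a set $L$ of specified leaks, $T(L)=\{x: x\rightarrow y\in L\}$ and $H(L)=\{y: x\rightarrow y\in L\}$. A set $B$ is a specified $\ell$-leaky forcing set if $B$ can color all of $G$ blue whenever any set of $\ell$ forces is prohibited; $\operatorname{Z}^s_{(\ell)}(G)$ is the minimum size of such a set. Two sets $L_1,L_2$ of specified leaks on $V(G)$ are isomorphic if there is a bijection $\phi:V(G)\to V(G)$ with $x\rightarrow y\in L_1$ if and only if $\phi(x)\rightarrow\phi(y)\in L_2$. Given a set $L$ of specified leaks on $V(G)$, a set $B$ is an $L$-leaky forcing set if $B$ can color all of $G$ blue despite any set $L_1$ of specified leaks that is isomorphic to some $L_2\subseteq L$; $\operatorname{Z}_{(L)}(G)$ is the minimum size of an $L$-leaky forcing set. A set $L$ of specified leaks is independent if $|T(L)|=|L|$ and $T(L)\cap H(L)=\varnothing$; $I(L)$ is the size of a largest independent set of specified leaks contained in $L$.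 -}

module Defs where

open import Data.Nat using (ℕ; zero; suc; _+_; _≤_)
open import Data.Fin using (Fin; zero; suc)
open import Data.Bool using (Bool; true; false; if_then_else_; _∨_)
open import Data.Product using (Σ; _×_; _,_)
open import Relation.Binary.PropositionalEquality using (_≡_; _≢_)
open import Function.Bundles using (_↔_; Inverse)

record Graph (n : ℕ) : Set where
  field
    adj   : Fin n → Fin n → Bool
    sym   : ∀ x y → adj x y ≡ adj y x
    irrefl : ∀ x → adj x x ≡ false

open Graph public

Adj : ∀ {n} → Graph n → Fin n → Fin n → Set
Adj G x y = adj G x y ≡ true

VSet : ℕ → Set
VSet n = Fin n → Bool

-- A set of (ordered) pairs: L x y ≡ true means x → y ∈ L.
Leaks : ℕ → Set
Leaks n = Fin n → Fin n → Bool

card : ∀ {n} → (Fin n → Bool) → ℕ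
card {zero}  f = 0
card {suc n} f = (if f zero then 1 else 0) + card (λ i → f (suc i))

sumFin : ∀ {n} → (Fin n → ℕ) → ℕ
sumFin {zero}  f = 0
sumFin {suc n} f = f zero + sumFin (λ i → f (suc i))

anyFin : ∀ {n} → (Fin n → Bool) → Bool
anyFin {zero}  f = false
anyFin {suc n} f = f zero ∨ anyFin (λ i → f (suc i))

size : ∀ {n} → Leaks n → ℕ
size L = sumFin (λ x → card (L x))

tails : ∀ {n} → Leaks n → VSet n
tails L x = anyFin (λ y → L x y)

heads : ∀ {n} → Leaks n → VSet n
heads L y = anyFin (λ x → L x y)

_⊆L_ : ∀ {n} → Leaks n → Leaks n → Set
L₁ ⊆L L₂ = ∀ x y → L₁ x y ≡ true → L₂ x y ≡ true

IsLeakSet : ∀ {n} → Graph n → Leaks n → Set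
IsLeakSet G L = ∀ x y → L x y ≡ true → Adj G x y

LeakIso : ∀ {n} → Leaks n → Leaks n → Set
LeakIso {n} L₁ L₂ =
  Σ (Fin n ↔ Fin n) λ φ → ∀ x y → L₁ x y ≡ L₂ (Inverse.to φ x) (Inverse.to φ y)

Independent : ∀ {n} → Leaks n → Set
Independent L = (card (tails L) ≡ size L) × (∀ x → tails L x ≡ true → heads L x ≡ false)

IsIndepNum : ∀ {n} → Leaks n → ℕ → Set
IsIndepNum L ℓ =
  (Σ _ λ L' → (L' ⊆L L) × Independent L' × (size L' ≡ ℓ)) ×
  (∀ L' → L' ⊆L L → Independent L' → size L' ≤ ℓ)

-- Vertices eventually coloured blue, starting from B, when the forces in L are prohibited.
-- (Least set containing B and closed under the zero forcing rule with leaks L.)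
data Blue {n} (G : Graph n) (B : VSet n) (L : Leaks n) : Fin n → Set where
  init  : ∀ {x} → B x ≡ true → Blue G B L x
  force : ∀ {u x} → Blue G B L u → Adj G u x → L u x ≡ false →
          (∀ w → Adj G u w → w ≢ x → Blue G B L w) → Blue G B L x

Forces : ∀ {n} → Graph n → VSet n → Leaks n → Set
Forces G B L = ∀ x → Blue G B L x

SpecLeakyForcing : ∀ {n} → Graph n → ℕ → VSet n → Set
SpecLeakyForcing G ℓ B = ∀ L' → IsLeakSet G L' → size L' ≤ ℓ → Forces G B L'

LLeakyForcing : ∀ {n} → Graph n → Leaks n → VSet n → Set
LLeakyForcing G L B =
  ∀ L₁ L₂ → IsLeakSet G L₁ → L₂ ⊆L L → LeakIso L₁ L₂ → Forces G B L₁

-- Fix the leak set L₁ (isomorphic to some L₂ ⊆ L) and let S be the set of vertices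
-- coloured from B despite L₁. A leak u → x of L₁ can only matter if it is "stuck":
-- u ∈ S, x ∉ S and x is the only neighbour of u outside S. The stuck leaks J are
-- independent (each tail carries a single leak, every tail lies in S and every head
-- outside S), and their image under the isomorphism is an independent subset of L, so
-- |J| ≤ I(L) = ℓ. Hence B colours G despite J. But S is closed under every force that
-- J permits, so S is everything, i.e. B colours G despite L₁.
module Submission where

open import Defs hiding (sym)
open import Data.Nat using (ℕ; zero; suc; _+_; _≤_)
open import Data.Nat.Properties
  using (+-0-commutativeMonoid; 0≢1+n; suc-injective; module ≤-Reasoning)
open import Data.Fin using (Fin; zero; suc; _≟_; punchIn)
open import Data.Fin.Properties as Finₚ using (any?; all?; punchInᵢ≢i)
open import Data.Fin.Permutation using (Permutation′; _⟨$⟩ʳ_; _⟨$⟩ˡ_; inverseˡ; inverseʳ; flip)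
open import Data.Bool using (Bool; true; false; _∨_; not; if_then_else_) renaming (_≟_ to _≟ᵇ_)
open import Data.Bool.Properties using (¬-not; not-¬; ∨-zeroʳ; T-≡)
open import Data.Product using (∃; _×_; _,_; proj₁)
open import Function using (_∘_; Equivalence)
open import Relation.Nullary using (Dec; yes; no; ¬_; ¬?; contradiction)
open import Relation.Nullary.Decidable using (⌊_⌋; _×-dec_; _→-dec_; toWitness; fromWitness)
open import Relation.Binary.PropositionalEquality
  using (_≡_; _≢_; _≗_; refl; sym; trans; cong; cong₂; module ≡-Reasoning)
import Algebra.Properties.CommutativeMonoid.Sum as MonoidSum

open MonoidSum +-0-commutativeMonoid using (sum; sum-cong-≗; sum-permute; sum-remove)

indicator : Bool → ℕ
indicator b = if b then 1 else 0

sumFin-cong : ∀ {n} {f g : Fin n → ℕ} → f ≗ g → sumFin f ≡ sumFin g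
sumFin-cong {zero}  f≗g = refl
sumFin-cong {suc n} f≗g = cong₂ _+_ (f≗g zero) (sumFin-cong (f≗g ∘ suc))

sumFin≡sum : ∀ {n} (f : Fin n → ℕ) → sumFin f ≡ sum f
sumFin≡sum {zero}  f = refl
sumFin≡sum {suc n} f = cong (f zero +_) (sumFin≡sum (f ∘ suc))

card≡sumFin : ∀ {n} (f : Fin n → Bool) → card f ≡ sumFin (indicator ∘ f)
card≡sumFin {zero}  f = refl
card≡sumFin {suc n} f = cong (indicator (f zero) +_) (card≡sumFin (f ∘ suc))

card≡sum : ∀ {n} (f : Fin n → Bool) → card f ≡ sum (indicator ∘ f)
card≡sum f = trans (card≡sumFin f) (sumFin≡sum (indicator ∘ f))

sumFin-permute : ∀ {n} (π : Permutation′ n) (f : Fin n → ℕ) → sumFin (f ∘ (π ⟨$⟩ʳ_)) ≡ sumFin f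
sumFin-permute π f = begin
  sumFin (f ∘ (π ⟨$⟩ʳ_))  ≡⟨ sumFin≡sum (f ∘ (π ⟨$⟩ʳ_)) ⟩
  sum (f ∘ (π ⟨$⟩ʳ_))     ≡⟨ sum-permute f π ⟨
  sum f                   ≡⟨ sumFin≡sum f ⟨
  sumFin f                ∎
  where open ≡-Reasoning

card-permute : ∀ {n} (π : Permutation′ n) (f : Fin n → Bool) → card (f ∘ (π ⟨$⟩ʳ_)) ≡ card f
card-permute π f = begin
  card (f ∘ (π ⟨$⟩ʳ_))             ≡⟨ card≡sum (f ∘ (π ⟨$⟩ʳ_)) ⟩
  sum (indicator ∘ f ∘ (π ⟨$⟩ʳ_))  ≡⟨ sum-permute (indicator ∘ f) π ⟨
  sum (indicator ∘ f)              ≡⟨ card≡sum f ⟨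
  card f                           ∎
  where open ≡-Reasoning

card-remove : ∀ {n} {f g : Fin n → Bool} x → f x ≡ true → g x ≡ false →
              (∀ y → y ≢ x → f y ≡ g y) → card f ≡ suc (card g)
card-remove {suc n} {f} {g} x fx gx agree = begin
  card f                                   ≡⟨ card≡sum f ⟩
  sum (indicator ∘ f)                      ≡⟨ sum-remove {i = x} (indicator ∘ f) ⟩
  indicator (f x) + rest f                 ≡⟨ cong₂ _+_ (cong indicator fx) (sum-cong-≗ away-from-x) ⟩
  suc (rest g)                             ≡⟨ cong (λ b → suc (indicator b + rest g)) gx ⟨
  suc (indicator (g x) + rest g)           ≡⟨ cong suc (sum-remove {i = x} (indicator ∘ g)) ⟨
  suc (sum (indicator ∘ g))                ≡⟨ cong suc (card≡sum g) ⟨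
  suc (card g)                             ∎
  where
  open ≡-Reasoning
  rest : (Fin (suc n) → Bool) → ℕ
  rest h = sum (indicator ∘ h ∘ punchIn x)
  away-from-x : indicator ∘ f ∘ punchIn x ≗ indicator ∘ g ∘ punchIn x
  away-from-x j = cong indicator (agree (punchIn x j) (punchInᵢ≢i x j))

anyFin-witness : ∀ {n} (f : Fin n → Bool) → anyFin f ≡ true → ∃ λ x → f x ≡ true
anyFin-witness {suc n} f any-f with f zero in f0
... | true  = zero , f0
... | false with anyFin-witness (f ∘ suc) any-f
...   | x , fx = suc x , fx

AtMostOne : ∀ {n} → (Fin n → Bool) → Set
AtMostOne f = ∀ x y → f x ≡ true → f y ≡ true → x ≡ y

atMostOne-suc : ∀ {n} {f : Fin (suc n) → Bool} → AtMostOne f → AtMostOne (f ∘ suc)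
atMostOne-suc unique x y fx fy = Finₚ.suc-injective (unique (suc x) (suc y) fx fy)

card-atMostOne : ∀ {n} (f : Fin n → Bool) → AtMostOne f → card f ≡ indicator (anyFin f)
card-atMostOne {zero}  f unique = refl
card-atMostOne {suc n} f unique with f zero in f0
... | false = card-atMostOne (f ∘ suc) (atMostOne-suc unique)
... | true  = cong suc (trans (card-atMostOne (f ∘ suc) (atMostOne-suc unique))
                              (cong indicator rest-empty))
  where
  rest-empty : anyFin (f ∘ suc) ≡ false
  rest-empty = ¬-not λ any-rest → let x , fx = anyFin-witness (f ∘ suc) any-rest in
                                  contradiction (unique zero (suc x) f0 fx) λ ()

Functional : ∀ {n} → Leaks n → Set
Functional K = ∀ u → AtMostOne (K u)

TailsNotHeads : ∀ {n} → Leaks n → Set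
TailsNotHeads K = ∀ u x y → K u x ≡ true → K y u ≢ true

functional⇒card-tails≡size : ∀ {n} {K : Leaks n} → Functional K → card (tails K) ≡ size K
functional⇒card-tails≡size {K = K} functional = begin
  card (tails K)                 ≡⟨ card≡sumFin (tails K) ⟩
  sumFin (indicator ∘ tails K)   ≡⟨ sumFin-cong (λ u → card-atMostOne (K u) (functional u)) ⟨
  size K                         ∎
  where open ≡-Reasoning

independent : ∀ {n} {K : Leaks n} → Functional K → TailsNotHeads K → Independent K
independent {K = K} functional disjoint = functional⇒card-tails≡size functional , tail⇒¬head
  where
  tail⇒¬head : ∀ x → tails K x ≡ true → heads K x ≡ false
  tail⇒¬head x tail = ¬-not λ head →
    let y , Kxy = anyFin-witness (K x) tail
        z , Kzx = anyFin-witness (λ z → K z x) head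
    in disjoint x y z Kxy Kzx

relabel : ∀ {n} → Permutation′ n → Leaks n → Leaks n
relabel π K a b = K (π ⟨$⟩ʳ a) (π ⟨$⟩ʳ b)

size-relabel : ∀ {n} (π : Permutation′ n) (K : Leaks n) → size (relabel π K) ≡ size K
size-relabel π K = begin
  sumFin (λ a → card (K (π ⟨$⟩ʳ a) ∘ (π ⟨$⟩ʳ_)))  ≡⟨ sumFin-cong (λ a → card-permute π (K (π ⟨$⟩ʳ a))) ⟩
  sumFin (λ a → card (K (π ⟨$⟩ʳ a)))             ≡⟨ sumFin-permute π (card ∘ K) ⟩
  size K                                         ∎
  where open ≡-Reasoning

functional-relabel : ∀ {n} (π : Permutation′ n) {K : Leaks n} →
                     Functional K → Functional (relabel π K)
functional-relabel π functional u x y Kux Kuy = begin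
  x                          ≡⟨ inverseˡ π ⟨
  π ⟨$⟩ˡ (π ⟨$⟩ʳ x)          ≡⟨ cong (π ⟨$⟩ˡ_) (functional (π ⟨$⟩ʳ u) _ _ Kux Kuy) ⟩
  π ⟨$⟩ˡ (π ⟨$⟩ʳ y)          ≡⟨ inverseˡ π ⟩
  y                          ∎
  where open ≡-Reasoning

tailsNotHeads-relabel : ∀ {n} (π : Permutation′ n) {K : Leaks n} →
                        TailsNotHeads K → TailsNotHeads (relabel π K)
tailsNotHeads-relabel π disjoint u x y = disjoint (π ⟨$⟩ʳ u) (π ⟨$⟩ʳ x) (π ⟨$⟩ʳ y)

relabel-⊆-iso : ∀ {n} {K L₁ L₂ : Leaks n} ((φ , _) : LeakIso L₁ L₂) →
                K ⊆L L₁ → relabel (flip φ) K ⊆L L₂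
relabel-⊆-iso {L₁ = L₁} {L₂} (φ , iso) K⊆L₁ a b K′ab = begin
  L₂ a b                                   ≡⟨ cong₂ L₂ (inverseʳ φ) (inverseʳ φ) ⟨
  L₂ (φ ⟨$⟩ʳ (φ ⟨$⟩ˡ a)) (φ ⟨$⟩ʳ (φ ⟨$⟩ˡ b))  ≡⟨ iso (φ ⟨$⟩ˡ a) (φ ⟨$⟩ˡ b) ⟨
  L₁ (φ ⟨$⟩ˡ a) (φ ⟨$⟩ˡ b)                  ≡⟨ K⊆L₁ _ _ K′ab ⟩
  true                                     ∎
  where open ≡-Reasoning

_⊆_ : ∀ {n} → VSet n → VSet n → Set
S ⊆ T = ∀ {x} → S x ≡ true → T x ≡ true

insert : ∀ {n} → Fin n → VSet n → VSet n
insert x S y = ⌊ y ≟ x ⌋ ∨ S y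

⊆-insert : ∀ {n} x (S : VSet n) → S ⊆ insert x S
⊆-insert x S {y} Sy = trans (cong (⌊ y ≟ x ⌋ ∨_) Sy) (∨-zeroʳ _)

whites : ∀ {n} → VSet n → ℕ
whites S = card (not ∘ S)

whites-insert : ∀ {n} {S : VSet n} {x} → S x ≡ false → whites S ≡ suc (whites (insert x S))
whites-insert {S = S} {x} Sx = card-remove x (cong not Sx) x-inserted unchanged
  where
  x-inserted : not (insert x S x) ≡ false
  x-inserted with x ≟ x
  ... | yes _   = refl
  ... | no x≢x = contradiction refl x≢x
  unchanged : ∀ y → y ≢ x → not (S y) ≡ not (insert x S y)
  unchanged y y≢x with y ≟ x
  ... | yes y≡x = contradiction y≡x y≢x
  ... | no _    = refl

module _ {n} (G : Graph n) where

  OthersIn : VSet n → Fin n → Fin n → Set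
  OthersIn S u x = ∀ w → Adj G u w → w ≢ x → S w ≡ true

  othersIn? : ∀ S u x → Dec (OthersIn S u x)
  othersIn? S u x = all? λ w → (adj G u w ≟ᵇ true) →-dec ¬? (w ≟ x) →-dec (S w ≟ᵇ true)

  ForceClosed : Leaks n → VSet n → Set
  ForceClosed L S = ∀ {u x} → S u ≡ true → Adj G u x → L u x ≡ false → OthersIn S u x → S x ≡ true

  blue⊆forceClosed : ∀ {B S : VSet n} {L : Leaks n} → B ⊆ S → ForceClosed L S →
                     ∀ {x} → Blue G B L x → S x ≡ true
  blue⊆forceClosed B⊆S closed (init Bx) = B⊆S Bx
  blue⊆forceClosed B⊆S closed (force Bu ux leak others) =
    closed (blue⊆forceClosed B⊆S closed Bu) ux leak
           (λ w uw w≢x → blue⊆forceClosed B⊆S closed (others w uw w≢x))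

  Pending : Leaks n → VSet n → Fin n → Fin n → Set
  Pending L S u x = S u ≡ true × Adj G u x × L u x ≡ false × S x ≡ false × OthersIn S u x

  pending? : ∀ L S u x → Dec (Pending L S u x)
  pending? L S u x = (S u ≟ᵇ true) ×-dec (adj G u x ≟ᵇ true) ×-dec (L u x ≟ᵇ false) ×-dec
                     (S x ≟ᵇ false) ×-dec othersIn? S u x

  noPending⇒forceClosed : ∀ {L S} → (∀ u x → ¬ Pending L S u x) → ForceClosed L S
  noPending⇒forceClosed none {u} {x} Su ux leak others =
    ¬-not λ Sx → none u x (Su , ux , leak , Sx , others)

  insert-pending : ∀ {B S L u x} → Pending L S u x → (∀ {y} → S y ≡ true → Blue G B L y) →
                   ∀ {y} → insert x S y ≡ true → Blue G B L y
  insert-pending {x = x} (Su , ux , leak , _ , others) blue {y} inserted with y ≟ x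
  ... | yes refl = force (blue Su) ux leak (λ w uw w≢x → blue (others w uw w≢x))
  ... | no _     = blue inserted

  record Closure (L : Leaks n) (B : VSet n) : Set where
    field
      set         : VSet n
      ⊇-init      : B ⊆ set
      blue        : ∀ {x} → set x ≡ true → Blue G B L x
      forceClosed : ForceClosed L set

  -- k is fuel: each pending force inserts a new vertex, so k = whites S drops by one.
  closure-from : ∀ L B k S → whites S ≡ k → B ⊆ S → (∀ {x} → S x ≡ true → Blue G B L x) →
                 Closure L B
  closure-from L B k S #white B⊆S blue with any? (λ u → any? (pending? L S u))
  ... | no none = record
    { set = S ; ⊇-init = B⊆S ; blue = blue
    ; forceClosed = noPending⇒forceClosed λ u x p → none (u , x , p) }
  closure-from L B zero S #white B⊆S blue | yes (u , x , p@(_ , _ , _ , Sx , _)) =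
    contradiction (trans (sym #white) (whites-insert {S = S} Sx)) 0≢1+n
  closure-from L B (suc k) S #white B⊆S blue | yes (u , x , p@(_ , _ , _ , Sx , _)) =
    closure-from L B k (insert x S) (suc-injective (trans (sym (whites-insert {S = S} Sx)) #white))
                 (λ By → ⊆-insert x S (B⊆S By)) (insert-pending p blue)

  closure : ∀ L B → Closure L B
  closure L B = closure-from L B (whites B) B refl (λ Bx → Bx) init

  Stuck : Leaks n → VSet n → Fin n → Fin n → Set
  Stuck L S u x = L u x ≡ true × S u ≡ true × S x ≡ false × OthersIn S u x

  stuck : Leaks n → VSet n → Leaks n
  stuck L S u x =
    ⌊ (L u x ≟ᵇ true) ×-dec (S u ≟ᵇ true) ×-dec (S x ≟ᵇ false) ×-dec othersIn? S u x ⌋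

  module StuckLeaks (L : Leaks n) (S : VSet n) where

    stuck-sound : ∀ {u x} → stuck L S u x ≡ true → Stuck L S u x
    stuck-sound Jux = toWitness (Equivalence.from T-≡ Jux)

    stuck-complete : ∀ {u x} → Stuck L S u x → stuck L S u x ≡ true
    stuck-complete s = Equivalence.to T-≡ (fromWitness s)

    stuck-⊆ : stuck L S ⊆L L
    stuck-⊆ u x Jux = proj₁ (stuck-sound Jux)

    stuck-functional : IsLeakSet G L → Functional (stuck L S)
    stuck-functional leaks u x y Jux Juy with stuck-sound Jux | stuck-sound Juy | x ≟ y
    ... | _ | _ | yes x≡y = x≡y
    ... | _ , _ , _ , othersIn | Luy , _ , Sy , _ | no x≢y =
      contradiction Sy (not-¬ (othersIn y (leaks u y Luy) (x≢y ∘ sym)))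

    stuck-tailsNotHeads : TailsNotHeads (stuck L S)
    stuck-tailsNotHeads u x y Jux Jyu with stuck-sound Jux | stuck-sound Jyu
    ... | _ , Su , _ | _ , _ , Su′ , _ = not-¬ Su Su′

    stuck-forceClosed : ForceClosed L S → ForceClosed (stuck L S) S
    stuck-forceClosed closed Su ux notStuck others = ¬-not λ Sx →
      let unleaked = ¬-not λ Lux → not-¬ (stuck-complete (Lux , Su , Sx , others)) notStuck
      in not-¬ (closed Su ux unleaked others) Sx

theorem5p1 : ∀ {n} (G : Graph n) (L : Leaks n) (ℓ : ℕ) →
    IsLeakSet G L → IsIndepNum L ℓ →
    ∀ (B : VSet n) → SpecLeakyForcing G ℓ B → LLeakyForcing G L B
theorem5p1 G L ℓ _ (_ , maximal) B spec L₁ L₂ L₁-leaks L₂⊆L iso@(φ , _) x = blue (everything x)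
  where
  open Closure (closure G L₁ B)
  open StuckLeaks G L₁ set

  J : Leaks _
  J = stuck G L₁ set

  J′ : Leaks _
  J′ = relabel (flip φ) J

  J′⊆L : J′ ⊆L L
  J′⊆L a b J′ab = L₂⊆L a b (relabel-⊆-iso iso stuck-⊆ a b J′ab)

  J′-independent : Independent J′
  J′-independent = independent (functional-relabel (flip φ) (stuck-functional L₁-leaks))
                               (tailsNotHeads-relabel (flip φ) stuck-tailsNotHeads)

  J-small : size J ≤ ℓ
  J-small = begin
    size J   ≡⟨ size-relabel (flip φ) J ⟨
    size J′  ≤⟨ maximal J′ J′⊆L J′-independent ⟩
    ℓ        ∎
    where open ≤-Reasoning

  everything : ∀ y → set y ≡ true
  everything y = blue⊆forceClosed G ⊇-init (stuck-forceClosed forceClosed)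
                   (spec J (λ u v Juv → L₁-leaks u v (stuck-⊆ u v Juv)) J-small y)
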